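{- Let $H$ be a finite graph, $r,s\ge1$ integers, and $J=(A_1,\dots,A_N)$ an $(r,s)$-protocol that clears $H$. Then there exists a minimal $(r,s)$-protocol $J'=(A'_1,\dots,A'_N)$ that clears $H$ and satisfies $A'_i\subseteq A_i$ for $1\le i\le N$.
   Context: Discrete-time immunization model. Fix integers $r,s\ge 1$ and a finite graph $H$. An $(r,s)$-protocol for $H$ is a finite sequence $J=(A_1,\dots,A_N)$ of subsets of $V(H)$ ($A_t$ is the set of vertices immunized at time-step $t$); its width is $\max_i|A_i|$. At time-step $0$ every vertex is red. For each $t\ge 1$ every vertex lies in exactly one of $G_t^r,\dots,G_t^1$ (green), $Y_t^s,\dots,Y_t^1$ (yellow), $R_t$ (red), determined as follows: if $v\in A_t$ then $v\in G_t^r$. If $v\notin A_t$: if $v$ was red at time $t-1$ or $v\in Y_{t-1}^1$, then $v\in R_t$; if $v\in Y_{t-1}^i$ with $2\le i\le s$, then $v\in Y_t^{i-1}$; if $v\in G_{t-1}^i$ with $2\le i\le r$, then $v\in G_t^{i-1}$; if $v\in G_{t-1}^1$ and $v$ has a neighbor in $R_t$, then $v\in Y_t^s$; otherwise (i.e. $v\in G_{t-1}^1$ with no neighbor in $R_t$) $v\in G_t^1$. Let $G_t=\bigcup_i G_t^i$. The protocol clears $H$ if $G_N=V(H)$. The protocol is minimal if for all time-steps $t$ with $1\le t\le N$: whenever $v\in G_t^{\ell}$ and $v\in A_{t+1}$, $v$ has a neighbor in $R_{t+\ell}\cup R_{t+\ell+1}\cup\dots\cup R_{t+r}$. -}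

module Defs where

open import Data.Bool using (Bool; true; false; _∧_; _∨_; not; if_then_else_)
open import Data.Nat using (ℕ; zero; suc; _+_; _≤_; _<_)
open import Data.Fin using (Fin)
open import Data.Fin.Subset using (Subset; _⊆_; ⊥) public
open import Data.Vec using (Vec; []; _∷_; lookup)
open import Data.Bool.ListAction using (any)
open import Data.List.Base using (allFin)
open import Data.Product using (Σ; ∃; _×_; _,_)
open import Relation.Binary.PropositionalEquality using (_≡_)

record Graph : Set where
  field
    n      : ℕ
    adj    : Fin n → Fin n → Bool
    sym    : ∀ u v → adj u v ≡ adj v u
    irrefl : ∀ v → adj v v ≡ false
open Graph public

-- States of a vertex: green i  (G^i, 1 ≤ i ≤ r), yellow i (Y^i, 1 ≤ i ≤ s), red.
data State : Set where
  green  : ℕ → State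
  yellow : ℕ → State
  red    : State

isRedOrY1 : State → Bool
isRedOrY1 red            = true
isRedOrY1 (yellow 1)     = true
isRedOrY1 _              = false

Config : Graph → Set
Config H = Fin (n H) → State

-- u ∈ R_t, given A_t and the configuration at time t-1.
redNext : (H : Graph) → Subset (n H) → Config H → Fin (n H) → Bool
redNext H A c u = not (lookup A u) ∧ isRedOrY1 (c u)

hasRedNbr : (H : Graph) → Subset (n H) → Config H → Fin (n H) → Bool
hasRedNbr H A c v = any (λ u → adj H v u ∧ redNext H A c u) (allFin (n H))

stepState : (H : Graph) (r s : ℕ) → Subset (n H) → Config H → Fin (n H) → State → State
stepState H r s A c v red                  = red
stepState H r s A c v (yellow (suc (suc i))) = yellow (suc i)
stepState H r s A c v (yellow _)           = red
stepState H r s A c v (green (suc (suc i))) = green (suc i)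
stepState H r s A c v (green _)            =
  if hasRedNbr H A c v then yellow s else green 1

step : (H : Graph) (r s : ℕ) → Subset (n H) → Config H → Config H
step H r s A c v = if lookup A v then green r else stepState H r s A c v (c v)

-- A_t (1-based); A_0 and A_t for t > N are taken to be empty.
at : ∀ {m N} → Vec (Subset m) N → ℕ → Subset m
at []      t               = ⊥
at (A ∷ J) zero            = ⊥
at (A ∷ J) (suc zero)      = A
at (A ∷ J) (suc (suc t))   = at J (suc t)

conf : (H : Graph) (r s : ℕ) {N : ℕ} → Vec (Subset (n H)) N → ℕ → Config H
conf H r s J zero    = λ _ → red
conf H r s J (suc t) = step H r s (at J (suc t)) (conf H r s J t)

isGreen : State → Set
isGreen (green _) = Data.Unit.⊤ where import Data.Unit
isGreen _         = Data.Empty.⊥ where import Data.Empty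

Clears : (H : Graph) (r s : ℕ) {N : ℕ} → Vec (Subset (n H)) N → Set
Clears H r s {N} J = ∀ v → isGreen (conf H r s J N v)

Minimal : (H : Graph) (r s : ℕ) {N : ℕ} → Vec (Subset (n H)) N → Set
Minimal H r s {N} J =
  ∀ (t : ℕ) → 1 ≤ t → t ≤ N → ∀ (v : Fin (n H)) (ℓ : ℕ) →
    conf H r s J t v ≡ green ℓ → lookup (at J (suc t)) v ≡ true →
    Σ (Fin (n H)) λ u → adj H v u ≡ true ×
      Σ ℕ λ k → ℓ ≤ k × k ≤ r × conf H r s J (t + k) u ≡ red

-- If v ∈ G_t^ℓ is immunized at time t+1 although it has no neighbour in
-- R_{t+ℓ} ∪ … ∪ R_{t+r}, drop v from A_{t+1}.  In the new run v stays green: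
-- its counter runs down from ℓ instead of r, and it reaches 1 only at a time
-- t+k with ℓ ≤ k ≤ r, when it has no red neighbour and so stays in G¹.  Being
-- green, v is never red or in Y¹ in either run, so both runs produce the same
-- red sets and agree everywhere except at v, where the new counter trails the
-- old one until they coincide.  Hence the smaller protocol still clears H, and
-- repeating this decreases ∑ ∣A_i∣ until the protocol is minimal.
module Submission where

open import Defs hiding (sym)
open import Data.Bool using (true; false; _∧_; not; if_then_else_)
import Data.Bool.Properties as Bool
open import Data.Bool.ListAction using (or)
open import Data.Empty using (⊥-elim)
open import Data.Fin using (Fin; zero; suc; _≟_)
open import Data.Fin.Properties using (any?)
open import Data.Fin.Subset using (Subset; _⊆_; _─_; _-_; ∣_∣; ⁅_⁆; inside; outside)
open import Data.Fin.Subset.Properties using (p─⊥≡p; p─q⊆p; x∈p⇒∣p-x∣<∣p∣; ⊆-trans)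
open import Data.List using (allFin)
open import Data.List.Properties using (map-cong)
open import Data.List.Relation.Unary.Any using (satisfied)
open import Data.List.Relation.Unary.Any.Properties using (any⁻)
open import Data.Nat using (ℕ; zero; suc; _+_; _∸_; _≤_; _<_; z≤n; s≤s; s≤s⁻¹; _≤?_)
open import Data.Nat.Induction using (<-wellFounded)
open import Data.Nat.Properties hiding (_≟_)
open import Data.Product using (Σ; ∃; ∃₂; _×_; _,_; proj₁; proj₂)
open import Data.Sum using (_⊎_; inj₁; inj₂)
open import Data.Unit using (⊤; tt)
open import Data.Vec using (Vec; []; _∷_; lookup; sum; map)
open import Data.Vec.Properties using (lookup-replicate; lookup⇒[]=)
open import Function using (_∘_; id; Equivalence)
open import Induction.WellFounded using (Acc; acc)
open import Relation.Nullary using (¬_; Dec; yes; no; contradiction)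
open import Relation.Nullary.Decidable using (_×-dec_; ¬?; map′; decidable-stable)
open import Relation.Binary.PropositionalEquality

AgreeOff : ∀ {m} {X : Set} → Fin m → (Fin m → X) → (Fin m → X) → Set
AgreeOff v f g = ∀ w → w ≢ v → f w ≡ g w

⊥─p≡⊥ : ∀ {m} (p : Subset m) → ⊥ ─ p ≡ ⊥
⊥─p≡⊥ []            = refl
⊥─p≡⊥ (inside ∷ p)  = cong (outside ∷_) (⊥─p≡⊥ p)
⊥─p≡⊥ (outside ∷ p) = cong (outside ∷_) (⊥─p≡⊥ p)

x∉⊥ : ∀ {m} (x : Fin m) → lookup ⊥ x ≢ true
x∉⊥ x x∈⊥ with () ← trans (sym (lookup-replicate x outside)) x∈⊥

lookup-p-x≡false : ∀ {m} (p : Subset m) x → lookup (p - x) x ≡ false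
lookup-p-x≡false (b ∷ p) zero    = refl
lookup-p-x≡false (b ∷ p) (suc x) = lookup-p-x≡false p x

lookup-p-x : ∀ {m} (p : Subset m) x → AgreeOff x (lookup (p - x)) (lookup p)
lookup-p-x (b ∷ p) zero    zero    y≢x = contradiction refl y≢x
lookup-p-x (b ∷ p) zero    (suc y) _   = cong (λ q → lookup q y) (p─⊥≡p p)
lookup-p-x (b ∷ p) (suc x) zero    _   = refl
lookup-p-x (b ∷ p) (suc x) (suc y) y≢x = lookup-p-x p x y (y≢x ∘ cong suc)

Protocol : ℕ → ℕ → Set
Protocol m N = Vec (Subset m) N

_⊑_ : ∀ {m N} → Protocol m N → Protocol m N → Set
J′ ⊑ J = ∀ i → lookup J′ i ⊆ lookup J i

weight : ∀ {m N} → Protocol m N → ℕ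
weight J = sum (map ∣_∣ J)

-- Removes v from A_t, with the 1-based time-steps of `at`.
withdraw : ∀ {m N} → Protocol m N → ℕ → Fin m → Protocol m N
withdraw []      t             v = []
withdraw (A ∷ J) zero          v = A ∷ J
withdraw (A ∷ J) (suc zero)    v = (A - v) ∷ J
withdraw (A ∷ J) (suc (suc t)) v = A ∷ withdraw J (suc t) v

at-in-range : ∀ {m N} (J : Protocol m N) τ {v} → lookup (at J τ) v ≡ true → τ ≤ N
at-in-range []      τ             {v} v∈A = contradiction v∈A (x∉⊥ v)
at-in-range (A ∷ J) zero          v∈A = z≤n
at-in-range (A ∷ J) (suc zero)    v∈A = s≤s z≤n
at-in-range (A ∷ J) (suc (suc τ)) v∈A = s≤s (at-in-range J (suc τ) v∈A)

at-withdraw-≢ : ∀ {m N} (J : Protocol m N) {t τ} v → τ ≢ t → at (withdraw J t v) τ ≡ at J τ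
at-withdraw-≢ []      v _ = refl
at-withdraw-≢ (A ∷ J) {zero}        v _ = refl
at-withdraw-≢ (A ∷ J) {suc zero}    {zero}        v _ = refl
at-withdraw-≢ (A ∷ J) {suc zero}    {suc zero}    v τ≢t = contradiction refl τ≢t
at-withdraw-≢ (A ∷ J) {suc zero}    {suc (suc τ)} v _ = refl
at-withdraw-≢ (A ∷ J) {suc (suc t)} {zero}        v _ = refl
at-withdraw-≢ (A ∷ J) {suc (suc t)} {suc zero}    v _ = refl
at-withdraw-≢ (A ∷ J) {suc (suc t)} {suc (suc τ)} v τ≢t = at-withdraw-≢ J v (τ≢t ∘ cong suc)

at-withdraw : ∀ {m N} (J : Protocol m N) t v → at (withdraw J t v) t ≡ at J t - v
at-withdraw []      t             v = sym (⊥─p≡⊥ ⁅ v ⁆)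
at-withdraw (A ∷ J) zero          v = sym (⊥─p≡⊥ ⁅ v ⁆)
at-withdraw (A ∷ J) (suc zero)    v = refl
at-withdraw (A ∷ J) (suc (suc t)) v = at-withdraw J (suc t) v

withdraw-⊑ : ∀ {m N} (J : Protocol m N) t v → withdraw J t v ⊑ J
withdraw-⊑ (A ∷ J) zero          v i       = id
withdraw-⊑ (A ∷ J) (suc zero)    v zero    = p─q⊆p A ⁅ v ⁆
withdraw-⊑ (A ∷ J) (suc zero)    v (suc i) = id
withdraw-⊑ (A ∷ J) (suc (suc t)) v zero    = id
withdraw-⊑ (A ∷ J) (suc (suc t)) v (suc i) = withdraw-⊑ J (suc t) v i

withdraw-weight : ∀ {m N} (J : Protocol m N) t {v} → lookup (at J t) v ≡ true →
                  weight (withdraw J t v) < weight J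
withdraw-weight []      t             {v} v∈A = contradiction v∈A (x∉⊥ v)
withdraw-weight (A ∷ J) zero          {v} v∈A = contradiction v∈A (x∉⊥ v)
withdraw-weight (A ∷ J) (suc zero)    {v} v∈A =
  +-monoˡ-< (weight J) (x∈p⇒∣p-x∣<∣p∣ (lookup⇒[]= v A v∈A))
withdraw-weight (A ∷ J) (suc (suc t)) v∈A = +-monoʳ-< ∣ A ∣ (withdraw-weight J (suc t) v∈A)

-- The counter of a green vertex that is not immunized and meets no red
-- neighbour: G^{a+1} becomes G^a, and G^1 stays G^1.
tick : ℕ → ℕ
tick (suc (suc a)) = suc a
tick _             = 1

1≤tick : ∀ a → 1 ≤ tick a
1≤tick zero          = ≤-refl
1≤tick (suc zero)    = ≤-refl
1≤tick (suc (suc a)) = s≤s z≤n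

tick-mono-≤ : ∀ {a b} → a ≤ b → tick a ≤ tick b
tick-mono-≤ {zero}        {b}           _   = 1≤tick b
tick-mono-≤ {suc zero}    {b}           _   = 1≤tick b
tick-mono-≤ {suc (suc a)} {suc zero}    (s≤s ())
tick-mono-≤ {suc (suc a)} {suc (suc b)} a≤b = s≤s⁻¹ a≤b

tick≤ : ∀ {a} → 1 ≤ a → tick a ≤ a
tick≤ {suc zero}    _ = ≤-refl
tick≤ {suc (suc a)} _ = n≤1+n (suc a)

+-tick : ∀ a j → a + j ≤ tick a + suc j
+-tick zero          j = m≤n+m j 2
+-tick (suc zero)    j = n≤1+n (suc j)
+-tick (suc (suc a)) j = ≤-reflexive (sym (+-suc (suc a) j))

suc+tick : ∀ j {b} → 2 ≤ b → suc j + tick b ≡ j + b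
suc+tick j {suc zero}    (s≤s ())
suc+tick j {suc (suc b)} _ = sym (+-suc j (suc b))

Green≤ : ℕ → State → Set
Green≤ r (green a) = a ≤ r
Green≤ r _         = ⊤

green-injective : ∀ {a b} → green a ≡ green b → a ≡ b
green-injective refl = refl

red? : (x : State) → Dec (x ≡ red)
red? red        = yes refl
red? (green _)  = no λ ()
red? (yellow _) = no λ ()

module Dynamics (H : Graph) (r s : ℕ) where

  record SameRed (A′ : Subset (n H)) (c′ : Config H) (A : Subset (n H)) (c : Config H) : Set where
    constructor sameRed
    field redNext-≡ : ∀ w → redNext H A′ c′ w ≡ redNext H A c w

  redNext-green : ∀ A c {u a} → c u ≡ green a → redNext H A c u ≡ false
  redNext-green A c {u} cu≡green =
    trans (cong (λ x → not (lookup A u) ∧ isRedOrY1 x) cu≡green) (Bool.∧-zeroʳ _)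

  sameRed-off : ∀ {A′ A c′ c} v → AgreeOff v (lookup A′) (lookup A) → AgreeOff v c′ c →
                redNext H A′ c′ v ≡ redNext H A c v → SameRed A′ c′ A c
  sameRed-off v sameA samec at-v = sameRed λ w → at-w w (w ≟ v)
    where
    at-w : ∀ w → Dec (w ≡ v) → _
    at-w w (yes refl) = at-v
    at-w w (no w≢v)   = cong₂ (λ b x → not b ∧ isRedOrY1 x) (sameA w w≢v) (samec w w≢v)

  hasRedNbr-cong : ∀ {A′ A c′ c} u → SameRed A′ c′ A c → hasRedNbr H A′ c′ u ≡ hasRedNbr H A c u
  hasRedNbr-cong u same =
    cong or (map-cong (λ w → cong (adj H u w ∧_) (SameRed.redNext-≡ same w)) (allFin (n H)))

  stepState-cong : ∀ {A′ A c′ c} u → hasRedNbr H A′ c′ u ≡ hasRedNbr H A c u →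
                   ∀ x → stepState H r s A′ c′ u x ≡ stepState H r s A c u x
  stepState-cong u same red                   = refl
  stepState-cong u same (yellow zero)         = refl
  stepState-cong u same (yellow (suc zero))   = refl
  stepState-cong u same (yellow (suc (suc i))) = refl
  stepState-cong u same (green zero)          = cong (λ b → if b then yellow s else green 1) same
  stepState-cong u same (green (suc zero))    = cong (λ b → if b then yellow s else green 1) same
  stepState-cong u same (green (suc (suc i))) = refl

  step-cong : ∀ {A′ A c′ c} u → SameRed A′ c′ A c → lookup A′ u ≡ lookup A u → c′ u ≡ c u →
              step H r s A′ c′ u ≡ step H r s A c u
  step-cong {A′} {A} {c′} {c} u same sameA samec =
    cong₂ (λ b x → if b then green r else x) sameA
      (trans (cong (stepState H r s A′ c′ u) samec)
             (stepState-cong u (hasRedNbr-cong u same) (c u)))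

  step-≗ : ∀ A {c′ c} → c′ ≗ c → step H r s A c′ ≗ step H r s A c
  step-≗ A {c′} {c} c′≗c u = step-cong {A} {A} {c′} {c} u
    (sameRed λ w → cong (λ x → not (lookup A w) ∧ isRedOrY1 x) (c′≗c w)) refl (c′≗c u)

  step-agrees-off : ∀ {A′ A c′ c} v → SameRed A′ c′ A c → AgreeOff v (lookup A′) (lookup A) →
                    AgreeOff v c′ c → AgreeOff v (step H r s A′ c′) (step H r s A c)
  step-agrees-off v same sameA samec w w≢v =
    step-cong w same (sameA w w≢v) (samec w w≢v)

  step-immunized : ∀ A c {u} → lookup A u ≡ true → step H r s A c u ≡ green r
  step-immunized A c u∈A rewrite u∈A = refl

  step-tick : ∀ A c {u a} → lookup A u ≡ false → c u ≡ green a →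
              (a ≤ 1 → hasRedNbr H A c u ≡ false) → step H r s A c u ≡ green (tick a)
  step-tick A c {a = zero}        u∉A cu quiet rewrite u∉A | cu | quiet z≤n    = refl
  step-tick A c {a = suc zero}    u∉A cu quiet rewrite u∉A | cu | quiet ≤-refl = refl
  step-tick A c {a = suc (suc a)} u∉A cu _     rewrite u∉A | cu              = refl

  step-red : ∀ A c u → redNext H A c u ≡ true → step H r s A c u ≡ red
  step-red A c u red-u with lookup A u | c u
  step-red A c u ()    | true  | _
  step-red A c u _     | false | red                 = refl
  step-red A c u _     | false | yellow (suc zero)   = refl
  step-red A c u ()    | false | yellow zero
  step-red A c u ()    | false | yellow (suc (suc _))
  step-red A c u ()    | false | green _

  hasRedNbr⇒red-neighbour : ∀ A c v → hasRedNbr H A c v ≡ true →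
                            ∃ λ u → adj H v u ≡ true × step H r s A c u ≡ red
  hasRedNbr⇒red-neighbour A c v h =
    let (u , v~u∧red) = satisfied (any⁻ _ (allFin (n H)) (Equivalence.from Bool.T-≡ h))
        (v~u , u-red) = Equivalence.to Bool.T-∧ v~u∧red
    in u , Equivalence.to Bool.T-≡ v~u , step-red A c u (Equivalence.to Bool.T-≡ u-red)

  conf-Green≤ : 1 ≤ r → ∀ {N} (J : Protocol (n H) N) τ u → Green≤ r (conf H r s J τ u)
  conf-Green≤ 1≤r J zero    u = tt
  conf-Green≤ 1≤r J (suc τ) u =
    step-Green≤ (at J (suc τ)) (conf H r s J τ) (conf-Green≤ 1≤r J τ u)
    where
    alarm-Green≤ : ∀ b → Green≤ r (if b then yellow s else green 1)
    alarm-Green≤ true  = tt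
    alarm-Green≤ false = 1≤r

    stepState-Green≤ : ∀ A c x → Green≤ r x → Green≤ r (stepState H r s A c u x)
    stepState-Green≤ A c red                    _ = tt
    stepState-Green≤ A c (yellow zero)          _ = tt
    stepState-Green≤ A c (yellow (suc zero))    _ = tt
    stepState-Green≤ A c (yellow (suc (suc i))) _ = tt
    stepState-Green≤ A c (green zero)           _ = alarm-Green≤ (hasRedNbr H A c u)
    stepState-Green≤ A c (green (suc zero))     _ = alarm-Green≤ (hasRedNbr H A c u)
    stepState-Green≤ A c (green (suc (suc a)))  a≤r = ≤-trans (n≤1+n (suc a)) a≤r

    step-Green≤ : ∀ A c → Green≤ r (c u) → Green≤ r (step H r s A c u)
    step-Green≤ A c g with lookup A u
    ... | true  = ≤-refl
    ... | false = stepState-Green≤ A c (c u) g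

  RedNbrWithin : ∀ {N} → Protocol (n H) N → ℕ → Fin (n H) → ℕ → Set
  RedNbrWithin J t v ℓ = Σ (Fin (n H)) λ u → adj H v u ≡ true ×
    Σ ℕ λ k → ℓ ≤ k × k ≤ r × conf H r s J (t + k) u ≡ red

  Redundant : ∀ {N} → Protocol (n H) N → ℕ → Fin (n H) → Set
  Redundant J t v = Σ ℕ λ ℓ → conf H r s J t v ≡ green ℓ ×
    lookup (at J (suc t)) v ≡ true × ¬ RedNbrWithin J t v ℓ

  redNbrWithin? : ∀ {N} (J : Protocol (n H) N) t v ℓ → Dec (RedNbrWithin J t v ℓ)
  redNbrWithin? J t v ℓ = any? λ u → (adj H v u Bool.≟ true) ×-dec window? u
    where
    window? : ∀ u → Dec (Σ ℕ λ k → ℓ ≤ k × k ≤ r × conf H r s J (t + k) u ≡ red)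
    window? u = map′ (λ (k , k<1+r , ℓ≤k , u-red) → k , ℓ≤k , s≤s⁻¹ k<1+r , u-red)
                     (λ (k , ℓ≤k , k≤r , u-red) → k , s≤s k≤r , ℓ≤k , u-red)
                     (anyUpTo? (λ k → (ℓ ≤? k) ×-dec red? (conf H r s J (t + k) u)) (suc r))

  redundant? : ∀ {N} (J : Protocol (n H) N) t v → Dec (Redundant J t v)
  redundant? J t v with conf H r s J t v
  ... | green ℓ = map′
    (λ (v∈A , quiet) → ℓ , refl , v∈A , quiet)
    (λ (ℓ′ , v-green , v∈A , quiet) →
      v∈A , subst (¬_ ∘ RedNbrWithin J t v) (sym (green-injective v-green)) quiet)
    ((lookup (at J (suc t)) v Bool.≟ true) ×-dec ¬? (redNbrWithin? J t v ℓ))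
  ... | red      = no λ ()
  ... | yellow _ = no λ ()

  minimal-or-redundant : ∀ {N} (J : Protocol (n H) N) → Minimal H r s J ⊎ ∃₂ (Redundant J)
  minimal-or-redundant {N} J with anyUpTo? (λ t → any? (redundant? J t)) (suc N)
  ... | yes (t , _ , v , redundant) = inj₂ (t , v , redundant)
  ... | no none = inj₁ λ t _ t≤N v ℓ v-green v∈A →
    decidable-stable (redNbrWithin? J t v ℓ)
      (λ quiet → none (t , s≤s t≤N , v , ℓ , v-green , v∈A , quiet))

module Withdrawal (H : Graph) (r s : ℕ) (1≤r : 1 ≤ r) {N} (J : Protocol (n H) N)
  {t : ℕ} {v : Fin (n H)} {ℓ : ℕ}
  (v-green : conf H r s J t v ≡ green ℓ)
  (v∈A : lookup (at J (suc t)) v ≡ true)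
  (quiet : ¬ Dynamics.RedNbrWithin H r s J t v ℓ) where

  open Dynamics H r s

  J′ : Protocol (n H) N
  J′ = withdraw J (suc t) v

  c c′ : ℕ → Config H
  c  = conf H r s J
  c′ = conf H r s J′

  same-A : ∀ {τ} → τ ≢ t → at J′ (suc τ) ≡ at J (suc τ)
  same-A τ≢t = at-withdraw-≢ J v (τ≢t ∘ suc-injective)

  before : ∀ {τ} → τ ≤ t → c′ τ ≗ c τ
  before {zero}  _   u = refl
  before {suc τ} τ<t u = begin
    step H r s (at J′ (suc τ)) (c′ τ) u
      ≡⟨ cong (λ A → step H r s A (c′ τ) u) (same-A (<⇒≢ τ<t)) ⟩
    step H r s (at J (suc τ)) (c′ τ) u
      ≡⟨ step-≗ (at J (suc τ)) (before (<⇒≤ τ<t)) u ⟩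
    step H r s (at J (suc τ)) (c τ) u
      ∎
    where open ≡-Reasoning

  quiet-at : ∀ k → ℓ ≤ suc k → suc k ≤ r → hasRedNbr H (at J (suc k + t)) (c (k + t)) v ≡ false
  quiet-at k ℓ≤k+1 k+1≤r with hasRedNbr H (at J (suc k + t)) (c (k + t)) v in h
  ... | false = refl
  ... | true  =
    let (u , v~u , u-red) = hasRedNbr⇒red-neighbour (at J (suc k + t)) (c (k + t)) v h
    in ⊥-elim (quiet (u , v~u , suc k , ℓ≤k+1 , k+1≤r ,
                      trans (cong (λ τ → c τ u) (+-comm t (suc k))) u-red))

  -- j steps after time t, v is green with counter a in the run of J′ and
  -- with counter b > a in the run of J.
  record Trailing (j a b : ℕ) : Set where
    field
      1≤a     : 1 ≤ a
      a<b     : a < b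
      j+b≤1+r : j + b ≤ suc r
      ℓ≤a+j   : ℓ ≤ a + j

    2≤b : 2 ≤ b
    2≤b = ≤-trans (s≤s 1≤a) a<b

    next-in-window : suc j ≤ r
    next-in-window =
      s≤s⁻¹ (≤-trans (≤-trans (+-monoˡ-≤ j 2≤b) (≤-reflexive (+-comm b j))) j+b≤1+r)

  Lag : ℕ → State → State → Set
  Lag j x′ x = x′ ≡ x ⊎ ∃₂ λ a b → x′ ≡ green a × x ≡ green b × Trailing j a b

  lag-isGreen : ∀ {j x′ x} → Lag j x′ x → isGreen x → isGreen x′
  lag-isGreen (inj₁ x′≡x)                 = subst isGreen (sym x′≡x)
  lag-isGreen (inj₂ (_ , _ , x′≡green , _)) _ = subst isGreen (sym x′≡green) tt

  lag-intro : ∀ {j a b x′ x} → x′ ≡ green a → x ≡ green b →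
        1 ≤ a → a ≤ b → j + b ≤ suc r → ℓ ≤ a + j → Lag j x′ x
  lag-intro x′≡ x≡ 1≤a a≤b j+b≤1+r ℓ≤a+j with m≤n⇒m<n∨m≡n a≤b
  ... | inj₁ a<b  = inj₂ (_ , _ , x′≡ , x≡ , record
                      { 1≤a = 1≤a ; a<b = a<b ; j+b≤1+r = j+b≤1+r ; ℓ≤a+j = ℓ≤a+j })
  ... | inj₂ refl = inj₁ (trans x′≡ (sym x≡))

  Coupled : ℕ → ℕ → Set
  Coupled j τ = AgreeOff v (c′ τ) (c τ) × Lag j (c′ τ v) (c τ v)

  coupled-1 : Coupled 1 (suc t)
  coupled-1 = step-agrees-off v same same-A-off agree-at-t , v-lag
    where
    A′ A : Subset (n H)
    A′ = at J′ (suc t)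
    A  = at J (suc t)

    v∉A′ : lookup A′ v ≡ false
    v∉A′ = trans (cong (λ B → lookup B v) (at-withdraw J (suc t) v)) (lookup-p-x≡false A v)

    same-A-off : AgreeOff v (lookup A′) (lookup A)
    same-A-off w w≢v =
      trans (cong (λ B → lookup B w) (at-withdraw J (suc t) v)) (lookup-p-x A v w w≢v)

    agree-at-t : AgreeOff v (c′ t) (c t)
    agree-at-t w _ = before ≤-refl w

    v-green′ : c′ t v ≡ green ℓ
    v-green′ = trans (before ≤-refl v) v-green

    same : SameRed A′ (c′ t) A (c t)
    same = sameRed-off v same-A-off agree-at-t
             (trans (redNext-green A′ (c′ t) v-green′) (sym (redNext-green A (c t) v-green)))

    ℓ≤r : ℓ ≤ r
    ℓ≤r = subst (Green≤ r) v-green (conf-Green≤ 1≤r J t v)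

    v-lag : Lag 1 (c′ (suc t) v) (c (suc t) v)
    v-lag = lag-intro
      (step-tick A′ (c′ t) v∉A′ v-green′
        (λ ℓ≤1 → trans (hasRedNbr-cong v same) (quiet-at 0 ℓ≤1 1≤r)))
      (step-immunized A (c t) v∈A)
      (1≤tick ℓ) (≤-trans (tick-mono-≤ ℓ≤r) (tick≤ 1≤r)) ≤-refl
      (≤-trans (≤-reflexive (sym (+-identityʳ ℓ))) (+-tick ℓ 0))

  coupled-suc : ∀ i → Coupled (suc i) (suc i + t) → Coupled (suc (suc i)) (suc (suc i) + t)
  coupled-suc i (agree , v-lag) = step-agrees-off v same same-A-off agree , v-lag′ v-lag
    where
    τ = suc i + t
    A′ A : Subset (n H)
    A′ = at J′ (suc τ)
    A  = at J (suc τ)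

    A′≡A : A′ ≡ A
    A′≡A = same-A (≢-sym (<⇒≢ (m<n+m t (s≤s z≤n))))

    same-A-off : AgreeOff v (lookup A′) (lookup A)
    same-A-off w _ = cong (λ B → lookup B w) A′≡A

    same-at-v : Lag (suc i) (c′ τ v) (c τ v) → redNext H A′ (c′ τ) v ≡ redNext H A (c τ) v
    same-at-v (inj₁ c′≡c) = cong₂ (λ B x → not (lookup B v) ∧ isRedOrY1 x) A′≡A c′≡c
    same-at-v (inj₂ (_ , _ , c′-green , c-green , _)) =
      trans (redNext-green A′ (c′ τ) c′-green) (sym (redNext-green A (c τ) c-green))

    same : SameRed A′ (c′ τ) A (c τ)
    same = sameRed-off v same-A-off agree (same-at-v v-lag)

    v-lag′ : Lag (suc i) (c′ τ v) (c τ v) → Lag (suc (suc i)) (c′ (suc τ) v) (c (suc τ) v)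
    v-lag′ (inj₁ c′≡c) = inj₁ (step-cong v same (cong (λ B → lookup B v) A′≡A) c′≡c)
    v-lag′ (inj₂ (a , b , c′-green , c-green , trailing)) = by-immunization (lookup A v) refl
      where
      open Trailing trailing

      by-immunization : ∀ β → lookup A v ≡ β → Lag (suc (suc i)) (c′ (suc τ) v) (c (suc τ) v)
      by-immunization true immunized =
        inj₁ (trans (step-immunized A′ (c′ τ) (trans (cong (λ B → lookup B v) A′≡A) immunized))
                    (sym (step-immunized A (c τ) immunized)))
      by-immunization false not-immunized = lag-intro
        (step-tick A′ (c′ τ) (trans (cong (λ B → lookup B v) A′≡A) not-immunized) c′-green
          (λ a≤1 → trans (hasRedNbr-cong v same)
                     (quiet-at (suc i) (≤-trans ℓ≤a+j (+-monoˡ-≤ (suc i) a≤1)) next-in-window)))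
        (step-tick A (c τ) not-immunized c-green (λ b≤1 → contradiction (≤-trans 2≤b b≤1) 1+n≰n))
        (1≤tick a) (tick-mono-≤ (<⇒≤ a<b))
        (≤-trans (≤-reflexive (suc+tick (suc i) 2≤b)) j+b≤1+r)
        (≤-trans ℓ≤a+j (+-tick a (suc i)))

  coupled : ∀ i → Coupled (suc i) (suc i + t)
  coupled zero    = coupled-1
  coupled (suc i) = coupled-suc i (coupled i)

  coupled-at-N : Coupled (suc (N ∸ suc t)) N
  coupled-at-N = subst (Coupled (suc i))
    (trans (sym (+-suc i t)) (m∸n+n≡m (at-in-range J (suc t) v∈A))) (coupled i)
    where i = N ∸ suc t

  withdraw-Clears : Clears H r s J → Clears H r s J′
  withdraw-Clears clears u with u ≟ v
  ... | no u≢v   = subst isGreen (sym (proj₁ coupled-at-N u u≢v)) (clears u)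
  ... | yes refl = lag-isGreen (proj₂ coupled-at-N) (clears v)

module _ (H : Graph) (r s : ℕ) (1≤r : 1 ≤ r) where
  open Dynamics H r s

  minimise : ∀ {N} (J : Protocol (n H) N) → Acc _<_ (weight J) → Clears H r s J →
             Σ (Protocol (n H) N) λ J′ → Minimal H r s J′ × Clears H r s J′ × J′ ⊑ J
  minimise J (acc smaller) clears with minimal-or-redundant J
  ... | inj₁ minimal = J , minimal , clears , λ i → id
  ... | inj₂ (t , v , ℓ , v-green , v∈A , quiet) =
    let (J″ , minimal , clears″ , J″⊑J′) =
          minimise (withdraw J (suc t) v) (smaller (withdraw-weight J (suc t) v∈A))
            (Withdrawal.withdraw-Clears H r s 1≤r J v-green v∈A quiet clears)
    in J″ , minimal , clears″ , λ i → ⊆-trans (J″⊑J′ i) (withdraw-⊑ J (suc t) v i)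

proposition2p8 : (H : Graph) (r s : ℕ) → 1 ≤ r → 1 ≤ s →
    (N : ℕ) (J : Vec (Subset (n H)) N) → Clears H r s J →
    Σ (Vec (Subset (n H)) N) λ J′ →
      Minimal H r s J′ × Clears H r s J′ × (∀ (i : Fin N) → lookup J′ i ⊆ lookup J i)
proposition2p8 H r s 1≤r _ N J clears = minimise H r s 1≤r J (<-wellFounded (weight J)) clears
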